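{- Let $C\subseteq N$ with $|C|\ge 2$ and $k\in\{1,\ldots,|C|-1\}$. Define $\tau\in\mathbb{R}^{\Upsilon_c}$ by $$\tau(S)=\begin{cases}(-1)^{|S|-k-1}\binom{|S|-2}{|S|-k-1} & \text{if } S\subseteq C \text{ and } |S|\ge k+1,\\ 0 & \text{otherwise.}\end{cases}$$ Then for every $\eta\in\mathbb{R}^{\Upsilon}$, $$\sum_{S\in\Upsilon_c}\tau(S)\,c_\eta(S)=\sum_{a\in C}\ \sum_{B\subseteq N\setminus\{a\}:\,|B\cap C|\ge k}\eta(a|B),$$ so that in the characteristic-imset setting the $k$-cluster inequality $\sum_{a\in C}\sum_{B\subseteq N\setminus\{a\}:\,|B\cap C|\ge k}\eta(a|B)\le|C|-k$ takes the form $\sum_{S\in\Upsilon_c}\tau(S)\,c(S)\le|C|-k$.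
   Context: Let $N$ be a finite set with $n=|N|\ge 2$. Let $\Upsilon=\{(a|B): a\in N,\ \emptyset\neq B\subseteq N\setminus\{a\}\}$ and $\Upsilon_c=\{S\subseteq N:|S|\ge 2\}$. For $\eta\in\mathbb{R}^{\Upsilon}$, $c_\eta\in\mathbb{R}^{\Upsilon_c}$ is defined by $c_\eta(S)=\sum_{a\in S}\sum_{B:\,S\setminus\{a\}\subseteq B\subseteq N\setminus\{a\}}\eta(a|B)$. -}

module Defs where

open import Level using (Level)
open import Algebra.Bundles using (CommutativeRing)
open import Data.Nat as ℕ using (ℕ; zero; suc; _≤_; _≤?_; _∸_)
open import Data.Nat.Combinatorics using (_C_)
open import Data.Fin using (Fin)
open import Data.Fin.Subset using (Subset; outside; inside; _∈_; _∉_; _⊆_; _─_; _∩_; ⁅_⁆; ∣_∣)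
open import Data.Fin.Subset.Properties using (_∈?_; _⊆?_)
open import Data.List using (List; []; _∷_; _++_; map; filter; foldr; allFin)
open import Data.Vec using (Vec; []; _∷_)
open import Data.Product using (_×_)
open import Relation.Nullary using (Dec; yes; no; ¬?)
open import Relation.Nullary.Decidable using (_×-dec_)

allSubsets : (n : ℕ) → List (Subset n)
allSubsets zero = [] ∷ []
allSubsets (suc n) = map (outside ∷_) (allSubsets n) ++ map (inside ∷_) (allSubsets n)

module WithRing {c ℓ : Level} (R : CommutativeRing c ℓ) where
  open CommutativeRing R

  fromℕ : ℕ → Carrier
  fromℕ zero = 0#
  fromℕ (suc m) = 1# + fromℕ m

  signPow : ℕ → Carrier
  signPow zero = 1#
  signPow (suc m) = (- 1#) * signPow m

  sumList : {A : Set} → List A → (A → Carrier) → Carrier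
  sumList xs f = foldr (λ x acc → f x + acc) 0# xs

  module _ {n : ℕ} where
    sumFin : {P : Fin n → Set} → ((a : Fin n) → Dec (P a)) → (Fin n → Carrier) → Carrier
    sumFin P? f = sumList (filter P? (allFin n)) f

    sumSub : {P : Subset n → Set} → ((B : Subset n) → Dec (P B)) → (Subset n → Carrier) → Carrier
    sumSub P? f = sumList (filter P? (allSubsets n)) f

    -- η ∈ R^Υ is represented by a function on all pairs (a , B); only its values
    -- on pairs with a ∉ B, B ≠ ∅ are ever used below.
    Eta : Set c
    Eta = Fin n → Subset n → Carrier

    cη : Eta → Subset n → Carrier
    cη η S = sumFin (λ a → a ∈? S)
               (λ a → sumSub (λ B → ((S ─ ⁅ a ⁆) ⊆? B) ×-dec ¬? (a ∈? B)) (λ B → η a B))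

    τ : Subset n → ℕ → Subset n → Carrier
    τ Cl k S with (S ⊆? Cl) ×-dec (suc k ≤? ∣ S ∣)
    ... | yes _ = signPow (∣ S ∣ ∸ k ∸ 1) * fromℕ ((∣ S ∣ ∸ 2) C (∣ S ∣ ∸ k ∸ 1))
    ... | no _ = 0#

    lhs : Subset n → ℕ → Eta → Carrier
    lhs Cl k η = sumSub (λ S → 2 ≤? ∣ S ∣) (λ S → τ Cl k S * cη η S)

    rhs : Subset n → ℕ → Eta → Carrier
    rhs Cl k η = sumFin (λ a → a ∈? Cl)
                   (λ a → sumSub (λ B → ¬? (a ∈? B) ×-dec (k ≤? ∣ B ∩ Cl ∣)) (λ B → η a B))

-- Expanding c_η and exchanging the order of summation, the coefficient of η(a|B) on
-- the left is the sum of τ(S) over the sets S ∋ a with S ∖ {a} ⊆ B.  As τ vanishes off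
-- subsets of C, this is zero unless a ∈ C, and then it is Σₜ (m choose t) g(t) with
-- m = ∣B ∩ C∣, counting the t-subsets of B ∩ C, where g(t) = (-1)^(t-k) ((t-1) choose (t-k))
-- for t ≥ k (and 0 otherwise) is the value of τ on sets of size t + 1.  By Pascal's rule g is
-- the inverse binomial transform of m ↦ [k ≤ m], so the coefficient is [a ∈ C] [k ≤ ∣B ∩ C∣],
-- as on the right.

module Submission where

open import Defs
open import Level using (Level)
open import Algebra.Bundles using (CommutativeRing)
open import Data.Nat using (ℕ; _≤_; _<_)
open import Data.Fin using (Fin)
open import Data.Fin.Subset using (Subset; ∣_∣)

open import Data.Nat.Base as ℕ using (zero; suc; _∸_; _≤ᵇ_; s≤s)
import Data.Nat.Properties as ℕₚ
open import Data.Nat.Properties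
  using (_≤?_; +-suc; m≤n⇒m≤1+n; <⇒≤pred; m≤n⇒∃[o]m+o≡n; ≰⇒>; ∸-monoˡ-≤)
open import Data.Nat.Combinatorics using (nCn≡1; nCk+nC[k+1]≡[n+1]C[k+1])
  renaming (_C_ to _choose_)
open import Data.Fin.Base using (zero; suc)
open import Data.Fin.Subset using (_─_; ⁅_⁆; _∩_; _∈_; _∉_) renaming (⊥ to ∅)
open import Data.Fin.Subset.Properties using (_∈?_; _⊆?_; p─⊥≡p)
open import Data.Empty using (⊥-elim)
open import Function.Base using (_∘_)
open import Data.Bool.Base using (Bool; true; false; _∧_; not)
open import Data.List.Base using (List; []; _∷_; _++_; map; filter; allFin)
open import Data.Vec.Base using ([]; _∷_; here; there)
open import Data.Product.Base using (_,_)
open import Relation.Nullary using (Dec; does; yes; no; ¬?)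
open import Relation.Nullary.Decidable using (_×-dec_; dec-true)
open import Relation.Binary.PropositionalEquality as ≡ using (_≡_)
import Algebra.Properties.Ring as RingProperties
import Algebra.Properties.AbelianGroup as AbelianGroupProperties
import Algebra.Properties.CommutativeSemigroup as CommutativeSemigroupProperties
import Algebra.Solver.CommutativeMonoid as CommutativeMonoidSolver
import Relation.Binary.Reasoning.Setoid as SetoidReasoning

≤ᵇ-suc : ∀ k m → (suc k ≤ᵇ suc m) ≡ (k ≤ᵇ m)
≤ᵇ-suc zero m = ≡.refl
≤ᵇ-suc (suc k) m = ≡.refl

[1+m+n]∸m≡1+n : ∀ m n → suc (m ℕ.+ n) ∸ m ≡ suc n
[1+m+n]∸m≡1+n zero n = ≡.refl
[1+m+n]∸m≡1+n (suc m) n = [1+m+n]∸m≡1+n m n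

module _ {c ℓ : Level} (R : CommutativeRing c ℓ) where
  open CommutativeRing R hiding (zero)
  open WithRing R
  open RingProperties ring using (-1*x≈-x)
  open AbelianGroupProperties +-abelianGroup using (xyx⁻¹≈y; ⁻¹-∙-comm; ε⁻¹≈ε)
  open CommutativeSemigroupProperties +-commutativeSemigroup using () renaming (interchange to +-interchange)
  open SetoidReasoning setoid

  [_] : Bool → Carrier
  [ true ] = 1#
  [ false ] = 0#

  [∧] : ∀ x y → [ x ∧ y ] ≈ [ x ] * [ y ]
  [∧] true y = sym (*-identityˡ _)
  [∧] false y = sym (zeroˡ _)

  x*0*y≈0 : ∀ x y → x * (0# * y) ≈ 0#
  x*0*y≈0 x y = trans (*-congˡ (zeroˡ y)) (zeroʳ x)

  fromℕ-+ : ∀ m k → fromℕ (m ℕ.+ k) ≈ fromℕ m + fromℕ k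
  fromℕ-+ zero k = sym (+-identityˡ _)
  fromℕ-+ (suc m) k = trans (+-congˡ (fromℕ-+ m k)) (sym (+-assoc _ _ _))

  signPow-suc : ∀ r x → signPow (suc r) * x ≈ - (signPow r * x)
  signPow-suc r x = trans (*-assoc _ _ _) (-1*x≈-x _)

  module _ {A : Set} where

    sumList-cong : (xs : List A) {f g : A → Carrier} → (∀ x → f x ≈ g x) → sumList xs f ≈ sumList xs g
    sumList-cong [] f≈g = refl
    sumList-cong (x ∷ xs) f≈g = +-cong (f≈g x) (sumList-cong xs f≈g)

    sumList-zero : (xs : List A) {f : A → Carrier} → (∀ x → f x ≈ 0#) → sumList xs f ≈ 0#
    sumList-zero [] f≈0 = refl
    sumList-zero (x ∷ xs) f≈0 = trans (+-cong (f≈0 x) (sumList-zero xs f≈0)) (+-identityˡ 0#)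

    sumList-+ : (xs : List A) (f g : A → Carrier) →
                sumList xs (λ x → f x + g x) ≈ sumList xs f + sumList xs g
    sumList-+ [] f g = sym (+-identityˡ 0#)
    sumList-+ (x ∷ xs) f g = trans (+-congˡ (sumList-+ xs f g)) (+-interchange _ _ _ _)

    sumList-*ˡ : (xs : List A) (a : Carrier) (f : A → Carrier) →
                 sumList xs (λ x → a * f x) ≈ a * sumList xs f
    sumList-*ˡ [] a f = sym (zeroʳ a)
    sumList-*ˡ (x ∷ xs) a f = trans (+-congˡ (sumList-*ˡ xs a f)) (sym (distribˡ a (f x) _))

    sumList-*ʳ : (xs : List A) (a : Carrier) (f : A → Carrier) →
                 sumList xs (λ x → f x * a) ≈ sumList xs f * a
    sumList-*ʳ [] a f = sym (zeroˡ a)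
    sumList-*ʳ (x ∷ xs) a f = trans (+-congˡ (sumList-*ʳ xs a f)) (sym (distribʳ a (f x) _))

    sumList-++ : (xs ys : List A) (f : A → Carrier) →
                 sumList (xs ++ ys) f ≈ sumList xs f + sumList ys f
    sumList-++ [] ys f = sym (+-identityˡ _)
    sumList-++ (x ∷ xs) ys f = trans (+-congˡ (sumList-++ xs ys f)) (sym (+-assoc _ _ _))

    sumList-filter : {P : A → Set} (P? : (x : A) → Dec (P x)) (xs : List A) (f : A → Carrier) →
                     sumList (filter P? xs) f ≈ sumList xs (λ x → [ does (P? x) ] * f x)
    sumList-filter P? [] f = refl
    sumList-filter P? (x ∷ xs) f with does (P? x)
    ... | true = +-cong (sym (*-identityˡ _)) (sumList-filter P? xs f)
    ... | false = trans (sumList-filter P? xs f) (sym (trans (+-congʳ (zeroˡ _)) (+-identityˡ _)))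

  sumList-map : {A B : Set} (g : A → B) (xs : List A) (f : B → Carrier) →
                sumList (map g xs) f ≈ sumList xs (λ x → f (g x))
  sumList-map g [] f = refl
  sumList-map g (x ∷ xs) f = +-congˡ (sumList-map g xs f)

  sumList-comm : {A B : Set} (xs : List A) (ys : List B) (f : A → B → Carrier) →
                 sumList xs (λ x → sumList ys (f x)) ≈ sumList ys (λ y → sumList xs (λ x → f x y))
  sumList-comm [] ys f = sym (sumList-zero ys (λ _ → refl))
  sumList-comm (x ∷ xs) ys f = trans (+-congˡ (sumList-comm xs ys f)) (sym (sumList-+ ys (f x) _))

  sumList-filter₂ : {A B : Set} {P : A → Set} {Q : A → B → Set}
                    (P? : ∀ a → Dec (P a)) (Q? : ∀ a b → Dec (Q a b)) (xs : List A) (ys : List B)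
                    (f : A → B → Carrier) →
                    sumList (filter P? xs) (λ a → sumList (filter (Q? a) ys) (f a)) ≈
                    sumList xs (λ a → sumList ys (λ b → ([ does (P? a) ] * [ does (Q? a b) ]) * f a b))
  sumList-filter₂ P? Q? xs ys f = trans (sumList-filter P? xs _) (sumList-cong xs (λ a → begin
    [ does (P? a) ] * sumList (filter (Q? a) ys) (f a)
      ≈⟨ *-congˡ (sumList-filter (Q? a) ys (f a)) ⟩
    [ does (P? a) ] * sumList ys (λ b → [ does (Q? a b) ] * f a b)
      ≈⟨ sumList-*ˡ ys _ _ ⟨
    sumList ys (λ b → [ does (P? a) ] * ([ does (Q? a b) ] * f a b))
      ≈⟨ sumList-cong ys (λ b → *-assoc _ _ _) ⟨
    sumList ys (λ b → ([ does (P? a) ] * [ does (Q? a b) ]) * f a b) ∎))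

  sumSubsets : {n : ℕ} → (Subset n → Carrier) → Carrier
  sumSubsets {n} = sumList (allSubsets n)

  sumSubsets-suc : ∀ {n} (f : Subset (suc n) → Carrier) →
                   sumSubsets f ≈ sumSubsets (λ S → f (false ∷ S)) + sumSubsets (λ S → f (true ∷ S))
  sumSubsets-suc {n} f = trans (sumList-++ (map (false ∷_) (allSubsets n)) _ f)
    (+-cong (sumList-map (false ∷_) (allSubsets n) f) (sumList-map (true ∷_) (allSubsets n) f))

  -- binomialSum m h = Σₜ (m choose t) h t, the recursion being Pascal's rule.
  binomialSum : ℕ → (ℕ → Carrier) → Carrier
  binomialSum zero h = h 0
  binomialSum (suc m) h = binomialSum m h + binomialSum m (λ t → h (suc t))

  binomialSum-zero : ∀ m → binomialSum m (λ _ → 0#) ≈ 0#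
  binomialSum-zero zero = refl
  binomialSum-zero (suc m) = trans (+-cong (binomialSum-zero m) (binomialSum-zero m)) (+-identityˡ 0#)

  binomialSum-neg : ∀ m (f : ℕ → Carrier) → binomialSum m (λ t → - f t) ≈ - binomialSum m f
  binomialSum-neg zero f = refl
  binomialSum-neg (suc m) f =
    trans (+-cong (binomialSum-neg m f) (binomialSum-neg m (λ t → f (suc t)))) (⁻¹-∙-comm _ _)

  binomialSum-+ : ∀ m (f g : ℕ → Carrier) → binomialSum m (λ t → f t + g t) ≈ binomialSum m f + binomialSum m g
  binomialSum-+ zero f g = refl
  binomialSum-+ (suc m) f g =
    trans (+-cong (binomialSum-+ m f g) (binomialSum-+ m (λ t → f (suc t)) (λ t → g (suc t)))) (+-interchange _ _ _ _)

  sumSubsets-outside : ∀ {n} (f : Subset (suc n) → Carrier) {x : Carrier} →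
                       (∀ S → f (true ∷ S) ≈ 0#) → sumSubsets (λ S → f (false ∷ S)) ≈ x → sumSubsets f ≈ x
  sumSubsets-outside {n} f {x} inside≈0 outside≈x = begin
    sumSubsets f                                                         ≈⟨ sumSubsets-suc f ⟩
    sumSubsets (λ S → f (false ∷ S)) + sumSubsets (λ S → f (true ∷ S))  ≈⟨ +-cong outside≈x (sumList-zero (allSubsets n) inside≈0) ⟩
    x + 0#                                                               ≈⟨ +-identityʳ x ⟩
    x                                                                    ∎

  sumSubsets-⊆-size : ∀ {n} (B C : Subset n) (h : ℕ → Carrier) →
    sumSubsets (λ S → [ does (S ⊆? C) ] * ([ does (S ⊆? B) ] * h ∣ S ∣)) ≈ binomialSum ∣ B ∩ C ∣ h
  sumSubsets-⊆-size [] [] h = trans (+-identityʳ _) (trans (*-identityˡ _) (*-identityˡ _))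
  sumSubsets-⊆-size {suc n} (true ∷ B) (true ∷ C) h =
    trans (sumSubsets-suc {n} _) (+-cong (sumSubsets-⊆-size B C h) (sumSubsets-⊆-size B C (λ t → h (suc t))))
  sumSubsets-⊆-size {suc n} (false ∷ B) (true ∷ C) h =
    sumSubsets-outside {n} _ (λ S → x*0*y≈0 _ _) (sumSubsets-⊆-size B C h)
  sumSubsets-⊆-size {suc n} (true ∷ B) (false ∷ C) h =
    sumSubsets-outside {n} _ (λ S → zeroˡ _) (sumSubsets-⊆-size B C h)
  sumSubsets-⊆-size {suc n} (false ∷ B) (false ∷ C) h =
    sumSubsets-outside {n} _ (λ S → zeroˡ _) (sumSubsets-⊆-size B C h)

  sumSubsets-∋-size : ∀ {n} (a : Fin n) (B C : Subset n) (h : ℕ → Carrier) → a ∉ B →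
    sumSubsets (λ S → [ does (S ⊆? C) ] * ([ does (a ∈? S) ] * ([ does ((S ─ ⁅ a ⁆) ⊆? B) ] * h ∣ S ∣)))
      ≈ [ does (a ∈? C) ] * binomialSum ∣ B ∩ C ∣ (λ t → h (suc t))
  sumSubsets-∋-size zero (true ∷ B) C h a∉B = ⊥-elim (a∉B here)
  sumSubsets-∋-size {suc n} zero (false ∷ B) (true ∷ C) h a∉B = begin
    _ ≈⟨ sumSubsets-suc {n} _ ⟩
    _ ≈⟨ +-cong (sumList-zero (allSubsets n) (λ S → x*0*y≈0 _ _)) (sumList-cong (allSubsets n) without-a) ⟩
    0# + sumSubsets (λ S → [ does (S ⊆? C) ] * ([ does (S ⊆? B) ] * h (suc ∣ S ∣)))
      ≈⟨ +-identityˡ _ ⟩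
    _ ≈⟨ sumSubsets-⊆-size B C (λ t → h (suc t)) ⟩
    _ ≈⟨ *-identityˡ _ ⟨
    _ ∎
    where
    without-a : ∀ S → [ does (S ⊆? C) ] * (1# * ([ does ((S ─ ∅) ⊆? B) ] * h (suc ∣ S ∣)))
                  ≈ [ does (S ⊆? C) ] * ([ does (S ⊆? B) ] * h (suc ∣ S ∣))
    without-a S rewrite p─⊥≡p S = *-congˡ (*-identityˡ _)
  sumSubsets-∋-size {suc n} zero (false ∷ B) (false ∷ C) h a∉B =
    trans (sumSubsets-outside {n} _ (λ S → zeroˡ _) (sumList-zero (allSubsets n) (λ S → x*0*y≈0 _ _))) (sym (zeroˡ _))
  sumSubsets-∋-size {suc n} (suc a) (true ∷ B) (true ∷ C) h a∉B = begin
    _ ≈⟨ sumSubsets-suc {n} _ ⟩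
    _ ≈⟨ +-cong (sumSubsets-∋-size a B C h (a∉B ∘ there)) (sumSubsets-∋-size a B C (λ t → h (suc t)) (a∉B ∘ there)) ⟩
    _ ≈⟨ distribˡ _ _ _ ⟨
    _ ∎
  sumSubsets-∋-size {suc n} (suc a) (false ∷ B) (true ∷ C) h a∉B =
    sumSubsets-outside {n} _ (λ S → trans (*-congˡ (x*0*y≈0 _ _)) (zeroʳ _)) (sumSubsets-∋-size a B C h (a∉B ∘ there))
  sumSubsets-∋-size {suc n} (suc a) (true ∷ B) (false ∷ C) h a∉B =
    sumSubsets-outside {n} _ (λ S → zeroˡ _) (sumSubsets-∋-size a B C h (a∉B ∘ there))
  sumSubsets-∋-size {suc n} (suc a) (false ∷ B) (false ∷ C) h a∉B =
    sumSubsets-outside {n} _ (λ S → zeroˡ _) (sumSubsets-∋-size a B C h (a∉B ∘ there))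

  -- The inverse binomial transform of m ↦ [ k ≤ m ].
  clusterWeight : ℕ → ℕ → Carrier
  clusterWeight zero zero = 1#
  clusterWeight zero (suc t) = 0#
  clusterWeight (suc k) zero = 0#
  clusterWeight (suc k) (suc t) = clusterWeight k t - clusterWeight (suc k) t

  binomialSum-clusterWeight : ∀ k m → binomialSum m (clusterWeight k) ≈ [ k ≤ᵇ m ]
  binomialSum-clusterWeight zero zero = refl
  binomialSum-clusterWeight zero (suc m) =
    trans (+-cong (binomialSum-clusterWeight zero m) (binomialSum-zero m)) (+-identityʳ 1#)
  binomialSum-clusterWeight (suc k) zero = refl
  binomialSum-clusterWeight (suc k) (suc m) = begin
    x + binomialSum m (λ t → clusterWeight k t - clusterWeight (suc k) t)
      ≈⟨ +-congˡ (trans (binomialSum-+ m _ _) (+-congˡ (binomialSum-neg m _))) ⟩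
    x + (y - x)  ≈⟨ +-assoc x y (- x) ⟨
    x + y - x    ≈⟨ xyx⁻¹≈y x y ⟩
    y            ≈⟨ binomialSum-clusterWeight k m ⟩
    [ k ≤ᵇ m ]   ≡⟨ ≡.cong [_] (≤ᵇ-suc k m) ⟨
    [ suc k ≤ᵇ suc m ] ∎
    where
    x = binomialSum m (clusterWeight (suc k))
    y = binomialSum m (clusterWeight k)

  clusterWeight-below : ∀ j t → t ≤ j → clusterWeight (suc j) t ≈ 0#
  clusterWeight-below j zero _ = refl
  clusterWeight-below (suc j) (suc t) (s≤s t≤j) =
    trans (+-cong (clusterWeight-below j t t≤j) (-‿cong (clusterWeight-below (suc j) t (m≤n⇒m≤1+n t≤j))))
          (-‿inverseʳ 0#)

  clusterWeight-closed : ∀ j r → clusterWeight (suc j) (suc (j ℕ.+ r)) ≈ signPow r * fromℕ ((j ℕ.+ r) choose r)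
  clusterWeight-closed zero zero = trans (+-congˡ ε⁻¹≈ε) (sym (*-identityˡ _))
  clusterWeight-closed zero (suc r) = begin
    0# - clusterWeight 1 (suc r)                 ≈⟨ +-identityˡ _ ⟩
    - clusterWeight 1 (suc r)                    ≈⟨ -‿cong (clusterWeight-closed zero r) ⟩
    - (signPow r * fromℕ (r choose r))           ≈⟨ reflexive (≡.cong (λ m → - (signPow r * fromℕ m)) rCr≡[1+r]C[1+r]) ⟩
    - (signPow r * fromℕ (suc r choose suc r))   ≈⟨ signPow-suc r _ ⟨
    signPow (suc r) * fromℕ (suc r choose suc r) ∎
    where rCr≡[1+r]C[1+r] = ≡.trans (nCn≡1 r) (≡.sym (nCn≡1 (suc r)))
  clusterWeight-closed (suc j) zero =
    trans (+-cong (clusterWeight-closed j zero)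
                  (trans (-‿cong (clusterWeight-below (suc j) (suc (j ℕ.+ 0)) (s≤s (ℕₚ.≤-reflexive (ℕₚ.+-identityʳ j))))) ε⁻¹≈ε))
          (+-identityʳ _)
  clusterWeight-closed (suc j) (suc r) = begin
    clusterWeight (suc j) (suc N) - clusterWeight (suc (suc j)) (suc N)
      ≈⟨ +-cong (trans (clusterWeight-closed j (suc r)) (signPow-suc r _)) (-‿cong shifted) ⟩
    - (s * fromℕ (N choose suc r)) - s * fromℕ (N choose r)
      ≈⟨ ⁻¹-∙-comm _ _ ⟩
    - (s * fromℕ (N choose suc r) + s * fromℕ (N choose r))
      ≈⟨ -‿cong (trans (+-comm _ _) (sym (distribˡ s _ _))) ⟩
    - (s * (fromℕ (N choose r) + fromℕ (N choose suc r)))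
      ≈⟨ -‿cong (*-congˡ (fromℕ-+ (N choose r) (N choose suc r))) ⟨
    - (s * fromℕ (N choose r ℕ.+ N choose suc r))
      ≈⟨ reflexive (≡.cong (λ m → - (s * fromℕ m)) (nCk+nC[k+1]≡[n+1]C[k+1] N r)) ⟩
    - (s * fromℕ (suc N choose suc r))
      ≈⟨ signPow-suc r _ ⟨
    signPow (suc r) * fromℕ (suc N choose suc r) ∎
    where
    N = j ℕ.+ suc r
    s = signPow r
    shifted : clusterWeight (suc (suc j)) (suc N) ≈ s * fromℕ (N choose r)
    shifted = ≡.subst (λ m → clusterWeight (suc (suc j)) (suc m) ≈ s * fromℕ (m choose r))
                      (≡.sym (+-suc j r)) (clusterWeight-closed (suc j) r)

  τ-formula : ∀ j s → suc (suc j) ≤ s →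
    signPow (s ∸ suc j ∸ 1) * fromℕ ((s ∸ 2) choose (s ∸ suc j ∸ 1)) ≈ clusterWeight (suc j) (s ∸ 1)
  τ-formula j s 2+j≤s with m≤n⇒∃[o]m+o≡n 2+j≤s
  ... | r , ≡.refl rewrite [1+m+n]∸m≡1+n j r = sym (clusterWeight-closed j r)

  τ-clusterWeight : ∀ {n} (C S : Subset n) j →
    τ C (suc j) S ≈ [ does (S ⊆? C) ] * clusterWeight (suc j) (∣ S ∣ ∸ 1)
  τ-clusterWeight C S j with (S ⊆? C) ×-dec (suc (suc j) ≤? ∣ S ∣)
  ... | yes (S⊆C , 2+j≤∣S∣) = begin
    _                                                   ≈⟨ τ-formula j ∣ S ∣ 2+j≤∣S∣ ⟩
    clusterWeight (suc j) (∣ S ∣ ∸ 1)                   ≈⟨ *-identityˡ _ ⟨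
    1# * clusterWeight (suc j) (∣ S ∣ ∸ 1)              ≡⟨ ≡.cong (λ b → [ b ] * _) (dec-true (S ⊆? C) S⊆C) ⟨
    [ does (S ⊆? C) ] * clusterWeight (suc j) (∣ S ∣ ∸ 1) ∎
  ... | no ¬both with S ⊆? C
  ...   | no _ = sym (zeroˡ _)
  ...   | yes S⊆C = sym (trans (*-identityˡ _) (clusterWeight-below j (∣ S ∣ ∸ 1) ∣S∣∸1≤j))
    where
    ∣S∣∸1≤j : ∣ S ∣ ∸ 1 ≤ j
    ∣S∣∸1≤j = ∸-monoˡ-≤ 1 (<⇒≤pred (≰⇒> (λ 2+j≤∣S∣ → ¬both (S⊆C , 2+j≤∣S∣))))

  clusterWeight-size≥2 : ∀ j s → [ does (2 ≤? s) ] * clusterWeight (suc j) (s ∸ 1) ≈ clusterWeight (suc j) (s ∸ 1)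
  clusterWeight-size≥2 j zero = zeroˡ _
  clusterWeight-size≥2 j (suc zero) = zeroˡ _
  clusterWeight-size≥2 j (suc (suc s)) = *-identityˡ _

  module _ {n : ℕ} (C : Subset n) (j : ℕ) where

    pairWeight : Subset n → Fin n → Subset n → Carrier
    pairWeight S a B =
      ([ does (2 ≤? ∣ S ∣) ] * τ C (suc j) S) * ([ does (a ∈? S) ] * [ does ((S ─ ⁅ a ⁆) ⊆? B) ∧ not (does (a ∈? B)) ])

    lhs-summand : (η : Fin n → Subset n → Carrier) (S : Subset n) →
      [ does (2 ≤? ∣ S ∣) ] * (τ C (suc j) S * cη η S) ≈
      sumList (allFin n) (λ a → sumSubsets (λ B → pairWeight S a B * η a B))
    lhs-summand η S = begin
      [ does (2 ≤? ∣ S ∣) ] * (τ C (suc j) S * cη η S)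
        ≈⟨ *-assoc _ _ _ ⟨
      w * cη η S
        ≈⟨ *-congˡ (sumList-filter₂ (_∈? S) (λ a B → ((S ─ ⁅ a ⁆) ⊆? B) ×-dec ¬? (a ∈? B)) (allFin n) (allSubsets n) η) ⟩
      w * sumList (allFin n) (λ a → sumSubsets (λ B → e a B * η a B))
        ≈⟨ sumList-*ˡ (allFin n) w _ ⟨
      sumList (allFin n) (λ a → w * sumSubsets (λ B → e a B * η a B))
        ≈⟨ sumList-cong (allFin n) (λ a → sumList-*ˡ (allSubsets n) w _) ⟨
      sumList (allFin n) (λ a → sumSubsets (λ B → w * (e a B * η a B)))
        ≈⟨ sumList-cong (allFin n) (λ a → sumList-cong (allSubsets n) (λ B → *-assoc _ _ _)) ⟨
      sumList (allFin n) (λ a → sumSubsets (λ B → pairWeight S a B * η a B)) ∎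
      where
      w = [ does (2 ≤? ∣ S ∣) ] * τ C (suc j) S
      e : Fin n → Subset n → Carrier
      e a B = [ does (a ∈? S) ] * [ does ((S ─ ⁅ a ⁆) ⊆? B) ∧ not (does (a ∈? B)) ]

    weightOfSize : ℕ → Carrier
    weightOfSize s = clusterWeight (suc j) (s ∸ 1)

    pairWeight-factor : ∀ a B S → pairWeight S a B ≈
      ([ does (S ⊆? C) ] * ([ does (a ∈? S) ] * ([ does ((S ─ ⁅ a ⁆) ⊆? B) ] * weightOfSize ∣ S ∣))) * [ not (does (a ∈? B)) ]
    pairWeight-factor a B S = begin
      pairWeight S a B
        ≈⟨ *-cong (*-congˡ (τ-clusterWeight C S j)) (*-congˡ ([∧] (does ((S ─ ⁅ a ⁆) ⊆? B)) _)) ⟩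
      (d * (s⊆C * weightOfSize ∣ S ∣)) * (a∈S * (x * y))
        ≈⟨ reorder d s⊆C (weightOfSize ∣ S ∣) a∈S x y ⟩
      (s⊆C * (a∈S * (x * (d * weightOfSize ∣ S ∣)))) * y
        ≈⟨ *-congʳ (*-congˡ (*-congˡ (*-congˡ (clusterWeight-size≥2 j ∣ S ∣)))) ⟩
      (s⊆C * (a∈S * (x * weightOfSize ∣ S ∣))) * y ∎
      where
      open CommutativeMonoidSolver *-commutativeMonoid
      d = [ does (2 ≤? ∣ S ∣) ]
      s⊆C = [ does (S ⊆? C) ]
      a∈S = [ does (a ∈? S) ]
      x = [ does ((S ─ ⁅ a ⁆) ⊆? B) ]
      y = [ not (does (a ∈? B)) ]
      reorder : ∀ d s⊆C w a∈S x y → (d * (s⊆C * w)) * (a∈S * (x * y)) ≈ (s⊆C * (a∈S * (x * (d * w)))) * y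
      reorder = solve 6 (λ d s⊆C w a∈S x y → (d ⊕ (s⊆C ⊕ w)) ⊕ (a∈S ⊕ (x ⊕ y)) ⊜ (s⊆C ⊕ (a∈S ⊕ (x ⊕ (d ⊕ w)))) ⊕ y) refl

    sum-pairWeight : ∀ a B → sumSubsets (λ S → pairWeight S a B) ≈
                     [ does (a ∈? C) ] * [ not (does (a ∈? B)) ∧ (suc j ≤ᵇ ∣ B ∩ C ∣) ]
    sum-pairWeight a B =
      trans (sumList-cong (allSubsets n) (pairWeight-factor a B))
            (trans (sumList-*ʳ (allSubsets n) _ _) (by-membership (a ∈? B)))
      where
      weight = sumSubsets (λ S → [ does (S ⊆? C) ] * ([ does (a ∈? S) ] * ([ does ((S ─ ⁅ a ⁆) ⊆? B) ] * weightOfSize ∣ S ∣)))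
      by-membership : (a∈?B : Dec (a ∈ B)) → weight * [ not (does a∈?B) ] ≈
                      [ does (a ∈? C) ] * [ not (does a∈?B) ∧ (suc j ≤ᵇ ∣ B ∩ C ∣) ]
      by-membership (yes _) = trans (zeroʳ _) (sym (zeroʳ _))
      by-membership (no a∉B) = begin
        weight * 1#                                                        ≈⟨ *-identityʳ _ ⟩
        weight                                                             ≈⟨ sumSubsets-∋-size a B C weightOfSize a∉B ⟩
        [ does (a ∈? C) ] * binomialSum ∣ B ∩ C ∣ (clusterWeight (suc j))  ≈⟨ *-congˡ (binomialSum-clusterWeight (suc j) ∣ B ∩ C ∣) ⟩
        [ does (a ∈? C) ] * [ suc j ≤ᵇ ∣ B ∩ C ∣ ]                         ∎

    lhs≈rhs : (η : Fin n → Subset n → Carrier) → lhs C (suc j) η ≈ rhs C (suc j) η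
    lhs≈rhs η = begin
      lhs C (suc j) η
        ≈⟨ sumList-filter (λ S → 2 ≤? ∣ S ∣) (allSubsets n) _ ⟩
      sumSubsets (λ S → [ does (2 ≤? ∣ S ∣) ] * (τ C (suc j) S * cη η S))
        ≈⟨ sumList-cong (allSubsets n) (lhs-summand η) ⟩
      sumSubsets (λ S → sumList (allFin n) (λ a → sumSubsets (λ B → pairWeight S a B * η a B)))
        ≈⟨ sumList-comm (allSubsets n) (allFin n) _ ⟩
      sumList (allFin n) (λ a → sumSubsets (λ S → sumSubsets (λ B → pairWeight S a B * η a B)))
        ≈⟨ sumList-cong (allFin n) (λ a → sumList-comm (allSubsets n) (allSubsets n) _) ⟩
      sumList (allFin n) (λ a → sumSubsets (λ B → sumSubsets (λ S → pairWeight S a B * η a B)))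
        ≈⟨ sumList-cong (allFin n) (λ a → sumList-cong (allSubsets n) (λ B →
             trans (sumList-*ʳ (allSubsets n) (η a B) _) (*-congʳ (sum-pairWeight a B)))) ⟩
      sumList (allFin n) (λ a → sumSubsets (λ B →
        ([ does (a ∈? C) ] * [ not (does (a ∈? B)) ∧ (suc j ≤ᵇ ∣ B ∩ C ∣) ]) * η a B))
        ≈⟨ sumList-filter₂ (_∈? C) (λ a B → ¬? (a ∈? B) ×-dec (suc j ≤? ∣ B ∩ C ∣)) (allFin n) (allSubsets n) η ⟨
      rhs C (suc j) η ∎

lemma11 : {c ℓ : Level} (R : CommutativeRing c ℓ) (n : ℕ) → 2 ≤ n →
    (C : Subset n) → 2 ≤ ∣ C ∣ → (k : ℕ) → 1 ≤ k → k < ∣ C ∣ →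
    (η : Fin n → Subset n → CommutativeRing.Carrier R) →
    CommutativeRing._≈_ R (WithRing.lhs R C k η) (WithRing.rhs R C k η)
lemma11 R n _ C _ (suc j) _ _ η = lhs≈rhs R C j η
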